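{- Let $S=\{C_1,\dots,C_n\}$ be a finite set of propositional clauses containing no tautologies and no pure literal clauses. If $S$ is unsatisfiable, then there exists a deduction sequence of contradiction separation based on standard extension from $S$ to the empty clause $\emptyset$.
   Context: Propositional logic. A literal is a propositional variable or its negation; $p$ and $\neg p$ are complementary. A clause is a finite disjunction of literals, identified with the finite set of its literals; $\emptyset$ is the empty clause. A tautology is a clause containing a complementary pair. A pure literal clause is a clause containing a literal whose complement occurs in no clause of $S$. Contradiction separation based on standard extension: let $m\ge2$, let $D_1,\dots,D_m$ be clauses (repetitions allowed) and $x_1,\dots,x_{m-1}$ literals, and suppose sub-clauses $D_i^-\subseteq D_i$ are chosen with $D_1^-=\{x_1\}$, $D_i^-=\{x_i,\neg x_{i-1}\}\cup D^i$ for $2\le i\le m-1$, $D_m^-=\{\neg x_{m-1}\}\cup D^m$, where $D^2=\emptyset$ and $D^j\subseteq\{\neg x_1,\dots,\neg x_{j-2}\}$ for $3\le j\le m$. Put $D_i^+=D_i\setminus D_i^-$. Then $R_s(D_1,\dots,D_m)=\bigcup_{i=1}^m D_i^+$ is called a contradiction separation clause based on standard extension of $D_1,\dots,D_m$. A deduction sequence of contradiction separation based on standard extension from $S$ to $\phi_t$ is a finite sequence of clauses $\phi_1,\dots,\phi_t$ such that each $\phi_i$ either belongs to $S$, or there exist indices $r_1,\dots,r_{k_i}<i$ such that $\phi_i$ is a contradiction separation clause based on standard extension $R_s(\phi_{r_1},\dots,\phi_{r_{k_i}})$. -}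

module Defs where

open import Data.Nat using (ℕ; zero; suc; _≤_; _<_; _∸_; _≡ᵇ_)
open import Data.Bool using (Bool; true; false; not; if_then_else_)
open import Data.List using (List; []; _∷_)
open import Data.List.Membership.Propositional using (_∈_; _∉_)
open import Data.List.Relation.Unary.Any using (Any)
open import Data.List.Relation.Unary.All using (All)
open import Data.Product using (Σ; ∃; ∃-syntax; _×_)
open import Data.Sum using (_⊎_)
open import Relation.Nullary using (¬_)
open import Relation.Binary.PropositionalEquality using (_≡_)
open import Function.Bundles using (_⇔_)

record Literal : Set where
  constructor lit
  field
    var : ℕ
    pos : Bool
open Literal public

neg : Literal → Literal
neg (lit v b) = lit v (not b)

-- A clause is a finite set of literals, represented by a list;
-- only membership matters (clauses are compared as sets).
Clause : Set
Clause = List Literal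

_≈C_ : Clause → Clause → Set
C ≈C D = ∀ l → (l ∈ C) ⇔ (l ∈ D)

Assignment : Set
Assignment = ℕ → Bool

litTrue : Assignment → Literal → Set
litTrue α (lit v b) = α v ≡ b

clauseTrue : Assignment → Clause → Set
clauseTrue α C = Any (litTrue α) C

Satisfiable : List Clause → Set
Satisfiable S = ∃[ α ] All (clauseTrue α) S

Unsatisfiable : List Clause → Set
Unsatisfiable S = ¬ Satisfiable S

Tautology : Clause → Set
Tautology C = ∃[ l ] (l ∈ C × neg l ∈ C)

PureLiteralClause : List Clause → Clause → Set
PureLiteralClause S C = ∃[ l ] (l ∈ C × (∀ C' → C' ∈ S → neg l ∉ C'))

NoTautologies : List Clause → Set
NoTautologies S = ∀ C → C ∈ S → ¬ Tautology C

NoPureLiteralClauses : List Clause → Set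
NoPureLiteralClauses S = ∀ C → C ∈ S → ¬ PureLiteralClause S C

-- Indices are 1-based natural numbers: clauses D 1 … D m,
-- literals x 1 … x (m-1), extra sets Dsup j = D^j (2 ≤ j ≤ m).
Dminus : ℕ → (ℕ → Literal) → (ℕ → Clause) → ℕ → Clause
Dminus m x Ds (suc zero) = x 1 ∷ []
Dminus m x Ds i =
  if i ≡ᵇ m then neg (x (i ∸ 1)) ∷ Ds i
  else x i ∷ neg (x (i ∸ 1)) ∷ Ds i

IsCSClause : (m : ℕ) → (ℕ → Clause) → Clause → Set
IsCSClause m D R =
  2 ≤ m ×
  Σ (ℕ → Literal) λ x →
  Σ (ℕ → Clause) λ Ds →
    (Ds 2 ≡ []) ×
    (∀ j → 3 ≤ j → j ≤ m → ∀ l → l ∈ Ds j →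
       ∃[ k ] (1 ≤ k × k ≤ j ∸ 2 × l ≡ neg (x k))) ×
    (∀ i → 1 ≤ i → i ≤ m → ∀ l → l ∈ Dminus m x Ds i → l ∈ D i) ×
    (∀ l → (l ∈ R) ⇔ (∃[ i ] (1 ≤ i × i ≤ m × l ∈ D i × l ∉ Dminus m x Ds i)))

DeductionStep : List Clause → (ℕ → Clause) → ℕ → Set
DeductionStep S φ i =
  (∃[ C ] (C ∈ S × φ i ≈C C))
  ⊎ (∃[ k ] Σ (ℕ → ℕ) λ r →
       (∀ j → 1 ≤ j → j ≤ k → 1 ≤ r j × r j < i) ×
       IsCSClause k (λ j → φ (r j)) (φ i))

CSDeduction : List Clause → Clause → Set
CSDeduction S C =
  Σ ℕ λ t → Σ (ℕ → Clause) λ φ →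
    1 ≤ t × (∀ i → 1 ≤ i → i ≤ t → DeductionStep S φ i) × φ t ≈C C

module Submission where

-- Binary resolution is refutation complete: eliminating a variable p (keep the clauses without p,
-- replace those containing exactly one of p, ¬p by all their resolvents on p) preserves
-- unsatisfiability, and once no variable is left an unsatisfiable set contains the empty clause.
-- A resolution tree flattens into a sequence, and each binary resolution step is a contradiction
-- separation step with m = 2.

open import Defs
open import Data.Bool as Bool using (Bool; true; false)
open import Data.Empty using (⊥-elim)
open import Data.List using (List; []; _∷_; _++_; filter; length; map; concatMap; cartesianProductWith)
open import Data.List.Membership.Propositional using (_∈_; _∉_; find; lose)
open import Data.List.Membership.Propositional.Properties
  using (∈-++⁺ˡ; ∈-++⁺ʳ; ∈-++⁻; ∈-map⁺; ∈-filter⁺; ∈-filter⁻; ∈-concat⁺′;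
         ∈-cartesianProductWith⁺; ∈-cartesianProductWith⁻)
open import Data.List.Relation.Unary.Any using (here; there; any?)
open import Data.List.Relation.Unary.All as All using (All; all?)
open import Data.List.Relation.Unary.All.Properties.Core using (¬All⇒Any¬)
open import Data.Nat as ℕ using (ℕ; zero; suc; _≤_; _<_; _∸_; z≤n; s≤s)
open import Data.Nat.Properties
  using (+-∸-assoc; n∸n≡0; m≤n⇒m<n∨m≡n; m≤n⇒m≤1+n; ≤-refl; ≤-trans; <⇒≤)
open import Data.Product using (∃-syntax; _×_; _,_; proj₁; proj₂)
open import Data.Sum using (_⊎_; inj₁; inj₂)
open import Function.Bundles using (_⇔_; mk⇔; Equivalence)
open import Relation.Binary.Definitions using (DecidableEquality)
open import Relation.Binary.PropositionalEquality using (_≡_; _≢_; refl; sym; trans; cong; subst)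
open import Relation.Nullary using (¬_; Dec; yes; no)
open import Relation.Nullary.Decidable using (_×-dec_; ¬?)

open Equivalence

_≟ₗ_ : DecidableEquality Literal
lit v b ≟ₗ lit w c with v ℕ.≟ w | b Bool.≟ c
... | yes refl | yes refl = yes refl
... | no v≢w   | _        = no λ { refl → v≢w refl }
... | yes _    | no b≢c   = no λ { refl → b≢c refl }

open import Data.List.Membership.DecPropositional _≟ₗ_ using (_∈?_)

literal-of-var : ∀ l {p} → var l ≡ p → l ≡ lit p true ⊎ l ≡ lit p false
literal-of-var (lit v true)  refl = inj₁ refl
literal-of-var (lit v false) refl = inj₂ refl

litTrue? : ∀ α l → Dec (litTrue α l)
litTrue? α (lit v b) = α v Bool.≟ b

Resolvent : Clause → Clause → Literal → Clause → Set
Resolvent C₁ C₂ x R = ∀ l → (l ∈ R) ⇔ ((l ∈ C₁ × l ≢ x) ⊎ (l ∈ C₂ × l ≢ neg x))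

infix 4 _⊢_

data _⊢_ (S : List Clause) : Clause → Set where
  axiom   : ∀ {C} → C ∈ S → S ⊢ C
  resolve : ∀ {C₁ C₂ R} x → S ⊢ C₁ → S ⊢ C₂ → x ∈ C₁ → neg x ∈ C₂ → Resolvent C₁ C₂ x R →
            S ⊢ R

⊢-cut : ∀ {S T C} → (∀ {E} → E ∈ T → S ⊢ E) → T ⊢ C → S ⊢ C
⊢-cut S⊢T (axiom C∈T)              = S⊢T C∈T
⊢-cut S⊢T (resolve x d₁ d₂ x∈ ¬x∈ r) = resolve x (⊢-cut S⊢T d₁) (⊢-cut S⊢T d₂) x∈ ¬x∈ r

module Elimination (p : ℕ) where

  dropVar : Clause → Clause
  dropVar = filter (λ l → ¬? (var l ℕ.≟ p))

  ∈-dropVar⁺ : ∀ {l C} → l ∈ C → var l ≢ p → l ∈ dropVar C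
  ∈-dropVar⁺ = ∈-filter⁺ (λ l → ¬? (var l ℕ.≟ p))

  ∈-dropVar⁻ : ∀ {l} C → l ∈ dropVar C → l ∈ C × var l ≢ p
  ∈-dropVar⁻ C = ∈-filter⁻ (λ l → ¬? (var l ℕ.≟ p)) {xs = C}

  Positive Negative Absent : Clause → Set
  Positive C = lit p true ∈ C × lit p false ∉ C
  Negative C = lit p false ∈ C × lit p true ∉ C
  Absent   C = lit p true ∉ C × lit p false ∉ C

  positive? : ∀ C → Dec (Positive C)
  positive? C = (lit p true ∈? C) ×-dec ¬? (lit p false ∈? C)

  negative? : ∀ C → Dec (Negative C)
  negative? C = (lit p false ∈? C) ×-dec ¬? (lit p true ∈? C)

  absent? : ∀ C → Dec (Absent C)
  absent? C = ¬? (lit p true ∈? C) ×-dec ¬? (lit p false ∈? C)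

  absent-var : ∀ {C l} → Absent C → l ∈ C → var l ≢ p
  absent-var {l = l} (p∉ , ¬p∉) l∈ v≡p with literal-of-var l v≡p
  ... | inj₁ refl = p∉ l∈
  ... | inj₂ refl = ¬p∉ l∈

  resolveOnP : Clause → Clause → Clause
  resolveOnP C D = dropVar C ++ dropVar D

  resolveOnP-resolvent : ∀ {C D} → Positive C → Negative D → Resolvent C D (lit p true) (resolveOnP C D)
  resolveOnP-resolvent {C} {D} (_ , ¬p∉C) (_ , p∉D) l = mk⇔ split join
    where
    split : l ∈ resolveOnP C D → (l ∈ C × l ≢ lit p true) ⊎ (l ∈ D × l ≢ lit p false)
    split l∈ with ∈-++⁻ (dropVar C) l∈
    ... | inj₁ l∈C′ = let l∈C , v≢p = ∈-dropVar⁻ C l∈C′ in inj₁ (l∈C , λ e → v≢p (cong var e))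
    ... | inj₂ l∈D′ = let l∈D , v≢p = ∈-dropVar⁻ D l∈D′ in inj₂ (l∈D , λ e → v≢p (cong var e))
    join : (l ∈ C × l ≢ lit p true) ⊎ (l ∈ D × l ≢ lit p false) → l ∈ resolveOnP C D
    join (inj₁ (l∈C , l≢p)) = ∈-++⁺ˡ (∈-dropVar⁺ l∈C v≢p)
      where
      v≢p : var l ≢ p
      v≢p e with literal-of-var l e
      ... | inj₁ l≡p  = l≢p l≡p
      ... | inj₂ refl = ¬p∉C l∈C
    join (inj₂ (l∈D , l≢¬p)) = ∈-++⁺ʳ (dropVar C) (∈-dropVar⁺ l∈D v≢p)
      where
      v≢p : var l ≢ p
      v≢p e with literal-of-var l e
      ... | inj₁ refl = p∉D l∈D
      ... | inj₂ l≡¬p = l≢¬p l≡¬p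

  -- Clauses containing both p and ¬p are dropped: they are satisfied by every assignment.
  eliminate : List Clause → List Clause
  eliminate S = filter absent? S ++ cartesianProductWith resolveOnP (filter positive? S) (filter negative? S)

  ∈-eliminate⁻ : ∀ S {E} → E ∈ eliminate S →
                 (E ∈ S × Absent E) ⊎
                 ∃[ C ] ∃[ D ] (C ∈ S × Positive C × D ∈ S × Negative D × E ≡ resolveOnP C D)
  ∈-eliminate⁻ S E∈ with ∈-++⁻ (filter absent? S) E∈
  ... | inj₁ E∈Abs = inj₁ (∈-filter⁻ absent? E∈Abs)
  ... | inj₂ E∈Res with ∈-cartesianProductWith⁻ resolveOnP (filter positive? S) (filter negative? S) E∈Res
  ...   | C , D , C∈ , D∈ , refl = let C∈S , pos = ∈-filter⁻ positive? C∈
                                       D∈S , neg = ∈-filter⁻ negative? D∈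
                                   in inj₂ (C , D , C∈S , pos , D∈S , neg , refl)

  eliminate-derivable : ∀ S {E} → E ∈ eliminate S → S ⊢ E
  eliminate-derivable S E∈ with ∈-eliminate⁻ S E∈
  ... | inj₁ (E∈S , _) = axiom E∈S
  ... | inj₂ (C , D , C∈S , pos , D∈S , neg , refl) =
    resolve (lit p true) (axiom C∈S) (axiom D∈S) (proj₁ pos) (proj₁ neg) (resolveOnP-resolvent pos neg)

  eliminate-literal : ∀ S {E l} → E ∈ eliminate S → l ∈ E → var l ≢ p × ∃[ C ] (C ∈ S × l ∈ C)
  eliminate-literal S E∈ l∈E with ∈-eliminate⁻ S E∈
  ... | inj₁ (E∈S , abs) = absent-var abs l∈E , _ , E∈S , l∈E
  ... | inj₂ (C , D , C∈S , _ , D∈S , _ , refl) with ∈-++⁻ (dropVar C) l∈E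
  ...   | inj₁ l∈C′ = let l∈C , v≢p = ∈-dropVar⁻ C l∈C′ in v≢p , C , C∈S , l∈C
  ...   | inj₂ l∈D′ = let l∈D , v≢p = ∈-dropVar⁻ D l∈D′ in v≢p , D , D∈S , l∈D

  _[p≔_] : Assignment → Bool → Assignment
  (α [p≔ b ]) v with v ℕ.≟ p
  ... | yes _ = b
  ... | no  _ = α v

  update-other : ∀ α b {l} → var l ≢ p → litTrue α l → litTrue (α [p≔ b ]) l
  update-other α b {lit v c} v≢p t with v ℕ.≟ p
  ... | yes v≡p = ⊥-elim (v≢p v≡p)
  ... | no  _   = t

  update-p : ∀ α b → litTrue (α [p≔ b ]) (lit p b)
  update-p α b with p ℕ.≟ p
  ... | yes _   = refl
  ... | no  p≢p = ⊥-elim (p≢p refl)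

  dropVar-true : ∀ α b C → clauseTrue α (dropVar C) → clauseTrue (α [p≔ b ]) C
  dropVar-true α b C sat = let l , l∈ , t = find sat
                               l∈C , v≢p = ∈-dropVar⁻ C l∈
                           in lose l∈C (update-other α b v≢p t)

  absent-true : ∀ α b {C} → Absent C → clauseTrue α C → clauseTrue (α [p≔ b ]) C
  absent-true α b abs sat = let l , l∈C , t = find sat
                            in lose l∈C (update-other α b (absent-var abs l∈C) t)

  negative-true : ∀ α C {D} → ¬ clauseTrue α (dropVar C) → clauseTrue α (resolveOnP C D) →
                  clauseTrue (α [p≔ true ]) D
  negative-true α C {D} C-false sat with find sat
  ... | l , l∈ , t with ∈-++⁻ (dropVar C) l∈
  ...   | inj₁ l∈C′ = ⊥-elim (C-false (lose l∈C′ t))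
  ...   | inj₂ l∈D′ = dropVar-true α true D (lose l∈D′ t)

  absent∈eliminate : ∀ {S C} → C ∈ S → Absent C → C ∈ eliminate S
  absent∈eliminate C∈S abs = ∈-++⁺ˡ (∈-filter⁺ absent? C∈S abs)

  resolvent∈eliminate : ∀ S {C D} → C ∈ filter positive? S → D ∈ filter negative? S →
                        resolveOnP C D ∈ eliminate S
  resolvent∈eliminate S C∈ D∈ = ∈-++⁺ʳ (filter absent? S) (∈-cartesianProductWith⁺ resolveOnP C∈ D∈)

  -- If every positive clause is already satisfied without p, then p := false; otherwise a positive
  -- clause C₀ needs p := true, and each negative clause is satisfied through its resolvent with C₀.
  eliminate-satisfiable : ∀ S → Satisfiable (eliminate S) → Satisfiable S
  eliminate-satisfiable S (α , sat) with all? (λ C → any? (litTrue? α) (dropVar C)) (filter positive? S)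
  ... | yes positives-true = α [p≔ false ] , All.tabulate satisfied
    where
    satisfied : ∀ {C} → C ∈ S → clauseTrue (α [p≔ false ]) C
    satisfied {C} C∈S with lit p false ∈? C
    ... | yes ¬p∈ = lose ¬p∈ (update-p α false)
    ... | no ¬p∉ with lit p true ∈? C
    ...   | yes p∈ = dropVar-true α false C
                         (All.lookup positives-true (∈-filter⁺ positive? C∈S (p∈ , ¬p∉)))
    ...   | no p∉  = absent-true α false (p∉ , ¬p∉) (All.lookup sat (absent∈eliminate C∈S (p∉ , ¬p∉)))
  ... | no ¬positives-true with find (¬All⇒Any¬ (λ C → any? (litTrue? α) (dropVar C)) (filter positive? S)
                                                ¬positives-true)
  ...   | C₀ , C₀∈ , C₀-false = α [p≔ true ] , All.tabulate satisfied
    where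
    satisfied : ∀ {C} → C ∈ S → clauseTrue (α [p≔ true ]) C
    satisfied {C} C∈S with lit p true ∈? C
    ... | yes p∈ = lose p∈ (update-p α true)
    ... | no p∉ with lit p false ∈? C
    ...   | yes ¬p∈ = negative-true α C₀ C₀-false
                        (All.lookup sat (resolvent∈eliminate S C₀∈ (∈-filter⁺ negative? C∈S (¬p∈ , p∉))))
    ...   | no ¬p∉  = absent-true α true (p∉ , ¬p∉) (All.lookup sat (absent∈eliminate C∈S (p∉ , ¬p∉)))

VarsIn : List ℕ → List Clause → Set
VarsIn V S = ∀ {C} → C ∈ S → ∀ {l} → l ∈ C → var l ∈ V

eliminate-vars : ∀ p V S → VarsIn (p ∷ V) S → VarsIn V (Elimination.eliminate p S)
eliminate-vars p V S vars E∈ l∈E with Elimination.eliminate-literal p S E∈ l∈E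
... | v≢p , C , C∈S , l∈C with vars C∈S l∈C
...   | here v≡p = ⊥-elim (v≢p v≡p)
...   | there v∈V = v∈V

resolution-complete : ∀ V S → VarsIn V S → Unsatisfiable S → S ⊢ []
resolution-complete []      []            _    unsat = ⊥-elim (unsat ((λ _ → true) , All.[]))
resolution-complete []      ([] ∷ S)      _    _     = axiom (here refl)
resolution-complete []      ((l ∷ C) ∷ S) vars _     with vars (here refl) (here refl)
... | ()
resolution-complete (p ∷ V) S             vars unsat =
  ⊢-cut (eliminate-derivable S)
        (resolution-complete V (eliminate S) (eliminate-vars p V S vars)
                             (λ sat → unsat (eliminate-satisfiable S sat)))
  where open Elimination p

allVars : List Clause → List ℕ
allVars = concatMap (map var)

allVars-vars : ∀ S → VarsIn (allVars S) S
allVars-vars S C∈S l∈C = ∈-concat⁺′ (∈-map⁺ var l∈C) (∈-map⁺ (map var) C∈S)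

data Justified (S L : List Clause) (C : Clause) : Set where
  input    : C ∈ S → Justified S L C
  resolved : ∀ {C₁ C₂} x → C₁ ∈ L → C₂ ∈ L → x ∈ C₁ → neg x ∈ C₂ → Resolvent C₁ C₂ x C →
             Justified S L C

-- A linear resolution derivation, most recent clause first.
data Chain (S : List Clause) : List Clause → Set where
  []  : Chain S []
  _∷_ : ∀ {C L} → Justified S L C → Chain S L → Chain S (C ∷ L)

justified-weaken : ∀ {S L L′ C} → (∀ {D} → D ∈ L → D ∈ L′) → Justified S L C → Justified S L′ C
justified-weaken L⊆L′ (input C∈S)                = input C∈S
justified-weaken L⊆L′ (resolved x C₁∈ C₂∈ x∈ ¬x∈ r) =
  resolved x (L⊆L′ C₁∈) (L⊆L′ C₂∈) x∈ ¬x∈ r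

chain-++ : ∀ {S L₁ L₂} → Chain S L₁ → Chain S L₂ → Chain S (L₂ ++ L₁)
chain-++ c₁ []       = c₁
chain-++ c₁ (j ∷ c₂) = justified-weaken ∈-++⁺ˡ j ∷ chain-++ c₁ c₂

linearise : ∀ {S C} → S ⊢ C → ∃[ L ] Chain S (C ∷ L)
linearise (axiom C∈S) = [] , input C∈S ∷ []
linearise (resolve {C₁} {C₂} x d₁ d₂ x∈ ¬x∈ r) with linearise d₁ | linearise d₂
... | L₁ , c₁ | L₂ , c₂ =
  (C₂ ∷ L₂) ++ (C₁ ∷ L₁) ,
  resolved x (∈-++⁺ʳ (C₂ ∷ L₂) (here refl)) (here refl) x∈ ¬x∈ r ∷ chain-++ c₁ c₂

nth : List Clause → ℕ → Clause
nth []      _       = []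
nth (C ∷ _) zero    = C
nth (_ ∷ K) (suc n) = nth K n

-- The chain K read as a 1-based deduction sequence, oldest clause first.
sequence : List Clause → ℕ → Clause
sequence K i = nth K (length K ∸ i)

sequence-∷ : ∀ C L {j} → j ≤ length L → sequence (C ∷ L) j ≡ sequence L j
sequence-∷ C L j≤ = cong (nth (C ∷ L)) (+-∸-assoc 1 j≤)

sequence-last : ∀ C L → sequence (C ∷ L) (suc (length L)) ≡ C
sequence-last C L = cong (nth (C ∷ L)) (n∸n≡0 (length L))

∈⇒sequence-index : ∀ {D K} → D ∈ K → ∃[ j ] (1 ≤ j × j ≤ length K × sequence K j ≡ D)
∈⇒sequence-index {K = C ∷ L} (here refl) = suc (length L) , s≤s z≤n , ≤-refl , sequence-last C L
∈⇒sequence-index {K = C ∷ L} (there D∈L) =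
  let j , 1≤j , j≤ , eq = ∈⇒sequence-index D∈L
  in j , 1≤j , m≤n⇒m≤1+n j≤ , trans (sequence-∷ C L j≤) eq

IsCSClause-cong : ∀ {m D D′ R} → (∀ j → 1 ≤ j → j ≤ m → D j ≡ D′ j) →
                  IsCSClause m D R → IsCSClause m D′ R
IsCSClause-cong D≡D′ (2≤m , x , Ds , D²≡[] , extra , D⁻⊆D , separation) =
  2≤m , x , Ds , D²≡[] , extra ,
  (λ i 1≤i i≤m l l∈ → subst (l ∈_) (D≡D′ i 1≤i i≤m) (D⁻⊆D i 1≤i i≤m l l∈)) ,
  λ l → mk⇔ (λ l∈R → let i , 1≤i , i≤m , l∈D , l∉ = to (separation l) l∈R
                     in i , 1≤i , i≤m , subst (l ∈_) (D≡D′ i 1≤i i≤m) l∈D , l∉)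
            (λ { (i , 1≤i , i≤m , l∈D′ , l∉) →
                 from (separation l) (i , 1≤i , i≤m , subst (l ∈_) (sym (D≡D′ i 1≤i i≤m)) l∈D′ , l∉) })

DeductionStep-cong : ∀ {S φ φ′ i} → (∀ j → j ≤ i → φ j ≡ φ′ j) →
                     DeductionStep S φ i → DeductionStep S φ′ i
DeductionStep-cong {i = i} φ≡φ′ (inj₁ (C , C∈S , φi≈C)) =
  inj₁ (C , C∈S , subst (_≈C C) (φ≡φ′ i ≤-refl) φi≈C)
DeductionStep-cong {i = i} φ≡φ′ (inj₂ (k , r , bounds , cs)) =
  inj₂ (k , r , bounds ,
        subst (IsCSClause k _) (φ≡φ′ i ≤-refl)
              (IsCSClause-cong (λ j 1≤j j≤k → φ≡φ′ (r j) (<⇒≤ (proj₂ (bounds j 1≤j j≤k)))) cs))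

-- Binary resolution on x is the case m = 2, x₁ = x: then D₁⁻ = {x}, D₂⁻ = {¬x} and D² = ∅.
resolvent-isCSClause : ∀ D {C₁ C₂ x R} → D 1 ≡ C₁ → D 2 ≡ C₂ → x ∈ C₁ → neg x ∈ C₂ →
                       Resolvent C₁ C₂ x R → IsCSClause 2 D R
resolvent-isCSClause D {x = x} {R} refl refl x∈ ¬x∈ res =
  s≤s (s≤s z≤n) , (λ _ → x) , (λ _ → []) , refl ,
  (λ { _ (s≤s (s≤s (s≤s _))) (s≤s (s≤s ())) }) , D⁻⊆D , separation
  where
  D⁻ : ℕ → Clause
  D⁻ = Dminus 2 (λ _ → x) (λ _ → [])

  D⁻⊆D : ∀ i → 1 ≤ i → i ≤ 2 → ∀ l → l ∈ D⁻ i → l ∈ D i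
  D⁻⊆D 1 _ _ _ (here refl) = x∈
  D⁻⊆D 2 _ _ _ (here refl) = ¬x∈
  D⁻⊆D (suc (suc (suc _))) _ (s≤s (s≤s ()))

  ∉-singleton : ∀ {l y : Literal} → l ≢ y → l ∉ y ∷ []
  ∉-singleton l≢y (here l≡y) = l≢y l≡y

  Separated : Literal → Set
  Separated l = ∃[ i ] (1 ≤ i × i ≤ 2 × l ∈ D i × l ∉ D⁻ i)

  separation : ∀ l → (l ∈ R) ⇔ Separated l
  separation l = mk⇔ split join
    where
    split : l ∈ R → Separated l
    split l∈R with to (res l) l∈R
    ... | inj₁ (l∈D₁ , l≢x)  = 1 , s≤s z≤n , s≤s z≤n , l∈D₁ , ∉-singleton l≢x
    ... | inj₂ (l∈D₂ , l≢¬x) = 2 , s≤s z≤n , s≤s (s≤s z≤n) , l∈D₂ , ∉-singleton l≢¬x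
    join : Separated l → l ∈ R
    join (1 , _ , _ , l∈D₁ , l∉) = from (res l) (inj₁ (l∈D₁ , λ l≡x → l∉ (here l≡x)))
    join (2 , _ , _ , l∈D₂ , l∉) = from (res l) (inj₂ (l∈D₂ , λ l≡¬x → l∉ (here l≡¬x)))
    join (suc (suc (suc _)) , _ , s≤s (s≤s ()) , _)

≈C-refl : ∀ {C} → C ≈C C
≈C-refl _ = mk⇔ (λ l∈ → l∈) (λ l∈ → l∈)

justified-step : ∀ {S L C} → Justified S L C → DeductionStep S (sequence (C ∷ L)) (suc (length L))
justified-step {L = L} {C} (input C∈S) =
  inj₁ (C , C∈S , subst (_≈C C) (sym (sequence-last C L)) ≈C-refl)
justified-step {L = L} {C} (resolved x C₁∈ C₂∈ x∈ ¬x∈ res)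
  with ∈⇒sequence-index C₁∈ | ∈⇒sequence-index C₂∈
... | j₁ , 1≤j₁ , j₁≤ , φj₁≡C₁ | j₂ , 1≤j₂ , j₂≤ , φj₂≡C₂ =
  inj₂ (2 , r , bounds ,
        subst (IsCSClause 2 _) (sym (sequence-last C L))
              (resolvent-isCSClause _ (trans (sequence-∷ C L j₁≤) φj₁≡C₁)
                                      (trans (sequence-∷ C L j₂≤) φj₂≡C₂) x∈ ¬x∈ res))
  where
  r : ℕ → ℕ
  r 1 = j₁
  r _ = j₂
  bounds : ∀ j → 1 ≤ j → j ≤ 2 → 1 ≤ r j × r j < suc (length L)
  bounds 1 _ _ = 1≤j₁ , s≤s j₁≤
  bounds 2 _ _ = 1≤j₂ , s≤s j₂≤
  bounds (suc (suc (suc _))) _ (s≤s (s≤s ()))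

chain-steps : ∀ {S K} → Chain S K → ∀ i → 1 ≤ i → i ≤ length K → DeductionStep S (sequence K) i
chain-steps [] (suc _) (s≤s _) ()
chain-steps (_∷_ {C} {L} j c) i 1≤i i≤ with m≤n⇒m<n∨m≡n i≤
... | inj₁ (s≤s i≤L) =
  DeductionStep-cong (λ k k≤i → sym (sequence-∷ C L (≤-trans k≤i i≤L))) (chain-steps c i 1≤i i≤L)
... | inj₂ refl      = justified-step j

chain-deduction : ∀ {S C L} → Chain S (C ∷ L) → CSDeduction S C
chain-deduction {C = C} {L} c =
  suc (length L) , sequence (C ∷ L) , s≤s z≤n , chain-steps c ,
  subst (_≈C C) (sym (sequence-last C L)) ≈C-refl

theorem4p3 : (S : List Clause) → NoTautologies S → NoPureLiteralClauses S →
    Unsatisfiable S → CSDeduction S []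
theorem4p3 S _ _ unsat =
  chain-deduction (proj₂ (linearise (resolution-complete (allVars S) S (allVars-vars S) unsat)))
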